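{- Let $\tau$ be a finite relational signature, let $A\in\mathsf{FIN}(\tau)$, and let $\mathcal{C}$ be either $[A]_{\leftrightarrow}$ or $\uparrow A$. Then the following are equivalent: (i) $\mathcal{C}$ is decided by an adaptive right unbounded query algorithm over $\mathbb{B}$; (ii) $\mathcal{C}$ is decided by a non-adaptive right $k$-query algorithm over $\mathbb{B}$ for some $k$.
   Context: $\mathsf{FIN}(\tau)$ is the class of finite relational structures of signature $\tau$ with non-empty domain. $B\to A$ means there is a homomorphism from $B$ to $A$; $[A]_{\leftrightarrow}=\{B: A\to B\text{ and } B\to A\}$, $\uparrow A=\{B: A\to B\}$. $\hom_{\mathbb{B}}(D,F)$ is $1$ if $D\to F$ and $0$ otherwise. A non-adaptive right $k$-query algorithm over $\mathbb{B}$ is a pair $((F_1,\dots,F_k),X)$ with $F_i\in\mathsf{FIN}(\tau)$ and $X\subseteq\{0,1\}^k$; it decides $\{D:(\hom_{\mathbb{B}}(D,F_i))_{i=1}^k\in X\}$. For a set $\Sigma$, $\Sigma^{<\omega}$ is the set of finite strings over $\Sigma$; a subtree is a prefix-closed subset, a leaf an element with no proper extension. An adaptive right unbounded query algorithm over $\mathbb{B}$ is a function $G:\mathcal{T}\to\mathsf{FIN}(\tau)\cup\{\mathsf{YES},\mathsf{NO}\}$ with $\mathcal{T}\subseteq\{0,1\}^{<\omega}$ a subtree and $G(\sigma)\in\{\mathsf{YES},\mathsf{NO}\}$ iff $\sigma$ is a leaf; its computation path on $D$ is the limit of $\sigma_0=\varepsilon$, $\sigma_{i+1}=\sigma_i$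 if $G(\sigma_i)\in\{\mathsf{YES},\mathsf{NO}\}$, else $\sigma_{i+1}=\sigma_i\bullet\hom_{\mathbb{B}}(D,G(\sigma_i))$; it must be total (finite path on every input) and decides $\{D:G(\text{path of }D)=\mathsf{YES}\}$. -}

module Defs where

open import Data.Nat using (ℕ; suc)
open import Data.Fin using (Fin)
open import Data.Vec using (Vec; lookup; map)
open import Data.Bool using (Bool; true; false)
open import Data.List using (List; []; _∷_; _∷ʳ_; _++_)
open import Data.Product using (Σ; ∃; _×_; _,_)
open import Data.Sum using (_⊎_)
open import Relation.Binary.PropositionalEquality using (_≡_)
open import Relation.Nullary using (¬_)
open import Function.Bundles using (_⇔_)

record Signature : Set where
  field
    nrel  : ℕ
    arity : Fin nrel → ℕ
open Signature public

-- A finite τ-structure with NON-EMPTY domain Fin (suc n);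
-- each relation is a (finite, decidable) subset of tuples, given by a Bool-valued function.
record Struct (τ : Signature) : Set where
  field
    n   : ℕ
    rel : (R : Fin (nrel τ)) → Vec (Fin (suc n)) (arity τ R) → Bool
open Struct public

Dom : ∀ {τ} → Struct τ → Set
Dom A = Fin (suc (n A))

IsHom : ∀ {τ} (B A : Struct τ) → (Dom B → Dom A) → Set
IsHom {τ} B A f = ∀ (R : Fin (nrel τ)) (t : Vec (Dom B) (arity τ R)) →
                  rel B R t ≡ true → rel A R (map f t) ≡ true

_⟶_ : ∀ {τ} → Struct τ → Struct τ → Set
B ⟶ A = Σ (Dom B → Dom A) (IsHom B A)

Class : Signature → Set₁
Class τ = Struct τ → Set

HomEquivClass : ∀ {τ} → Struct τ → Class τ
HomEquivClass A B = (A ⟶ B) × (B ⟶ A)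

UpClass : ∀ {τ} → Struct τ → Class τ
UpClass A B = A ⟶ B

HomBit : ∀ {τ} → Struct τ → Struct τ → Bool → Set
HomBit D F b = (b ≡ true) ⇔ (D ⟶ F)

record NonAdaptive (τ : Signature) (k : ℕ) : Set where
  field
    queries : Vec (Struct τ) k
    accept  : Vec Bool k → Bool
open NonAdaptive public

NADecides : ∀ {τ k} → NonAdaptive τ k → Class τ → Set
NADecides {τ} {k} alg C =
  ∀ (D : Struct τ) (bs : Vec Bool k) →
    (∀ i → HomBit D (lookup (queries alg) i) (lookup bs i)) →
    (C D ⇔ (accept alg bs ≡ true))

data Label (τ : Signature) : Set where
  query : Struct τ → Label τ
  YES   : Label τ
  NO    : Label τ

data Answer : Set where
  yes no : Answer

-- Adaptive right unbounded query algorithm: a subtree 𝒯 ⊆ {0,1}^{<ω} (strings as lists,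
-- σ • b = σ ∷ʳ b) and a labelling G, whose values outside 𝒯 are irrelevant.
record Adaptive (τ : Signature) : Set₁ where
  field
    tree  : List Bool → Set
    label : List Bool → Label τ
    prefix-closed : ∀ σ ρ → tree (σ ++ ρ) → tree σ
    leaf-answer : ∀ σ → tree σ →
      ((label σ ≡ YES ⊎ label σ ≡ NO) ⇔ (¬ Σ Bool λ b → Σ (List Bool) λ ρ → tree (σ ++ (b ∷ ρ))))
open Adaptive public

data Run {τ} (alg : Adaptive τ) (D : Struct τ) : List Bool → Answer → Set where
  stop-yes : ∀ {σ} → tree alg σ → label alg σ ≡ YES → Run alg D σ yes
  stop-no  : ∀ {σ} → tree alg σ → label alg σ ≡ NO  → Run alg D σ no
  step     : ∀ {σ F b a} → tree alg σ → label alg σ ≡ query F → HomBit D F b →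
             Run alg D (σ ∷ʳ b) a → Run alg D σ a

ADecides : ∀ {τ} → Adaptive τ → Class τ → Set
ADecides {τ} alg C =
  (∀ (D : Struct τ) → ∃ λ a → Run alg D [] a) ×
  (∀ (D : Struct τ) → C D ⇔ Run alg D [] yes)

AdaptivelyDecidable : ∀ {τ} → Class τ → Set₁
AdaptivelyDecidable {τ} C = Σ (Adaptive τ) λ alg → ADecides alg C

NonAdaptivelyDecidable : ∀ {τ} → Class τ → Set
NonAdaptivelyDecidable {τ} C = Σ ℕ λ k → Σ (NonAdaptive τ k) λ alg → NADecides alg C

data Kind : Set where
  equivClass upClass : Kind

classOf : ∀ {τ} → Kind → Struct τ → Class τ
classOf equivClass A = HomEquivClass A
classOf upClass    A = UpClass A

{-# OPTIONS --safe #-}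
-- (ii) ⇒ (i): ask the k queries one after the other and answer according to X; the
-- resulting algorithm is total because hom_𝔹 is computable on finite structures.
--
-- (i) ⇒ (ii): the adaptive algorithm accepts A after finitely many queries F₁, …, F_k with
-- answers b₁, …, b_k, and every D answering these queries the same way follows the same
-- path, so is accepted too. For [A]↔ the answers hom_𝔹(D, F) only depend on the class of D,
-- so D ∈ [A]↔ iff D answers every F_i by b_i. For ↑A one asks the exponentials F_i^A
-- (written A ⊸ F_i) instead, as D × A → F iff D → F^A, and A → F^A implies A → F.
-- If A → D, then D → F_i^A forces A → F_i. Conversely, if D → F_i^A implies A → F_i for
-- every i, then D × A, which maps to A, answers every F_i exactly as A does; hence D × A
-- is accepted and A → D × A → D.
module Submission where

open import Defs
open import Data.Nat using (ℕ; zero; suc; _+_; _*_; _^_; pred)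
open import Data.Nat.Properties using (suc-pred; m^n≢0)
open import Data.Fin using (Fin; zero; suc; combine; quotient; remainder; cast; funToFin; finToFun)
open import Data.Fin.Properties using (remQuot-combine; cast-involutive; finToFun-funToFin; all?; any?)
open import Data.Vec using (Vec; []; _∷_; lookup; map; zipWith; tabulate)
open import Data.Vec.Properties using (map-cong; map-∘; map-id; lookup-map; lookup∘tabulate; zipWith-map₁)
open import Data.Bool using (Bool; true; false; _≟_)
open import Data.List using (List; []; _∷_; _++_)
open import Data.Product using (Σ; _×_; _,_; proj₁; proj₂)
open import Data.Sum using (_⊎_; inj₁; inj₂)
open import Data.Unit using (⊤; tt)
open import Data.Empty using (⊥; ⊥-elim)
open import Relation.Nullary using (Dec; does; ¬_; contradiction) renaming (yes to yesᵈ; no to noᵈ)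
open import Relation.Nullary.Decidable using (map′; _×-dec_; _→-dec_)
open import Relation.Binary.PropositionalEquality using (_≡_; _≗_; refl; sym; trans; cong; cong₂; subst)
open import Function using (_∘_; id)
open import Function.Bundles using (_⇔_; mk⇔; Equivalence)

open Equivalence using (to; from)

does⇔ : ∀ {P : Set} (p? : Dec P) → (does p? ≡ true) ⇔ P
does⇔ (yesᵈ p) = mk⇔ (λ _ → p) (λ _ → refl)
does⇔ (noᵈ ¬p) = mk⇔ (λ ()) (λ p → contradiction p ¬p)

≡-by-truth : ∀ {b c : Bool} {P Q : Set} →
             (b ≡ true) ⇔ P → (c ≡ true) ⇔ Q → (P → Q) → (Q → P) → b ≡ c
≡-by-truth {true}  {true}  _   _   _   _   = refl
≡-by-truth {false} {false} _   _   _   _   = refl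
≡-by-truth {true}  {false} b⇔P c⇔Q P⇒Q _   = sym (from c⇔Q (P⇒Q (to b⇔P refl)))
≡-by-truth {false} {true}  b⇔P c⇔Q _   Q⇒P = from b⇔P (Q⇒P (to c⇔Q refl))

allVec? : ∀ {m r} {P : Vec (Fin m) r → Set} → (∀ v → Dec (P v)) → Dec (∀ v → P v)
allVec? {r = zero}  P? = map′ (λ p → λ { [] → p }) (λ p → p []) (P? [])
allVec? {r = suc r} P? =
  map′ (λ p → λ { (x ∷ v) → p x v }) (λ p x v → p (x ∷ v)) (all? λ x → allVec? (P? ∘ (x ∷_)))

zipWith-diagonal : ∀ {A B : Set} {r} (f : A → A → B) (xs : Vec A r) →
                   zipWith f xs xs ≡ map (λ x → f x x) xs
zipWith-diagonal f []       = refl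
zipWith-diagonal f (x ∷ xs) = cong (f x x ∷_) (zipWith-diagonal f xs)

module _ {A B C : Set} where

  zipWith-factor : ∀ {D : Set} {r} {f : A → B → D} {g : C → D} {k : A → B → C} →
                   (∀ x y → f x y ≡ g (k x y)) → (xs : Vec A r) (ys : Vec B r) →
                   zipWith f xs ys ≡ map g (zipWith k xs ys)
  zipWith-factor f≡g∘k []       []       = refl
  zipWith-factor f≡g∘k (x ∷ xs) (y ∷ ys) =
    cong₂ _∷_ (f≡g∘k x y) (zipWith-factor f≡g∘k xs ys)

  map-zipWith-fst : ∀ {r} {g : C → A} {k : A → B → C} → (∀ x y → g (k x y) ≡ x) →
                    (xs : Vec A r) (ys : Vec B r) → map g (zipWith k xs ys) ≡ xs
  map-zipWith-fst g∘k≡fst []       []       = refl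
  map-zipWith-fst g∘k≡fst (x ∷ xs) (y ∷ ys) =
    cong₂ _∷_ (g∘k≡fst x y) (map-zipWith-fst g∘k≡fst xs ys)

  map-zipWith-snd : ∀ {r} {g : C → B} {k : A → B → C} → (∀ x y → g (k x y) ≡ y) →
                    (xs : Vec A r) (ys : Vec B r) → map g (zipWith k xs ys) ≡ ys
  map-zipWith-snd g∘k≡snd []       []       = refl
  map-zipWith-snd g∘k≡snd (x ∷ xs) (y ∷ ys) =
    cong₂ _∷_ (g∘k≡snd x y) (map-zipWith-snd g∘k≡snd xs ys)

module _ {τ : Signature} where

  Holds : (D : Struct τ) (R : Fin (nrel τ)) → Vec (Dom D) (arity τ R) → Set
  Holds D R t = rel D R t ≡ true

  IsHom-resp-≗ : ∀ {D F : Struct τ} {f g : Dom D → Dom F} → f ≗ g → IsHom D F f → IsHom D F g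
  IsHom-resp-≗ {F = F} f≗g f-hom R t Rt = subst (Holds F R) (map-cong f≗g t) (f-hom R t Rt)

  ⟶-refl : ∀ {A : Struct τ} → A ⟶ A
  ⟶-refl {A} = id , λ R t Rt → subst (Holds A R) (sym (map-id t)) Rt

  ⟶-trans : ∀ {A B C : Struct τ} → A ⟶ B → B ⟶ C → A ⟶ C
  ⟶-trans {C = C} (f , f-hom) (g , g-hom) =
    g ∘ f , λ R t Rt → subst (Holds C R) (sym (map-∘ g f t)) (g-hom R (map f t) (f-hom R t Rt))

  isHom? : (D F : Struct τ) (f : Dom D → Dom F) → Dec (IsHom D F f)
  isHom? D F f = all? λ R → allVec? λ t → (rel D R t ≟ true) →-dec (rel F R (map f t) ≟ true)

  hom? : (D F : Struct τ) → Dec (D ⟶ F)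
  hom? D F = map′ (λ (c , c-hom) → finToFun c , c-hom)
                  (λ (f , f-hom) → funToFin f , IsHom-resp-≗ {D} {F} (sym ∘ finToFun-funToFin f) f-hom)
                  (any? λ c → isHom? D F (finToFun c))

  homBit : Struct τ → Struct τ → Bool
  homBit D F = does (hom? D F)

  homBit-spec : (D F : Struct τ) → HomBit D F (homBit D F)
  homBit-spec D F = does⇔ (hom? D F)

  infixl 25 _⊗_
  infixr 25 _⊸_

  module _ (D A : Struct τ) where

    ⊗-fst : Fin (suc (n D) * suc (n A)) → Dom D
    ⊗-fst = quotient (suc (n A))

    ⊗-snd : Fin (suc (n D) * suc (n A)) → Dom A
    ⊗-snd = remainder {suc (n D)} (suc (n A))

    ⊗-rel? : ∀ R t → Dec (Holds D R (map ⊗-fst t) × Holds A R (map ⊗-snd t))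
    ⊗-rel? R t = (rel D R (map ⊗-fst t) ≟ true) ×-dec (rel A R (map ⊗-snd t) ≟ true)

  _⊗_ : Struct τ → Struct τ → Struct τ
  D ⊗ A = record { n = n A + n D * suc (n A) ; rel = λ R t → does (⊗-rel? D A R t) }

  module _ (D A : Struct τ) where

    rel-⊗ : ∀ R t →
            Holds (D ⊗ A) R t ⇔ (Holds D R (map (⊗-fst D A) t) × Holds A R (map (⊗-snd D A) t))
    rel-⊗ R t = does⇔ (⊗-rel? D A R t)

    π₁ : D ⊗ A ⟶ D
    π₁ = ⊗-fst D A , λ R t Rt → proj₁ (to (rel-⊗ R t) Rt)

    π₂ : D ⊗ A ⟶ A
    π₂ = ⊗-snd D A , λ R t Rt → proj₂ (to (rel-⊗ R t) Rt)

  -- Domains have the form Fin (suc n), so the codes Fin (b ^ a) of functions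
  -- Fin a → Fin b are cast along suc (pred (b ^ a)) ≡ b ^ a.
  module _ (a b : ℕ) where

    private
      codes-nonempty : suc (pred (suc b ^ suc a)) ≡ suc b ^ suc a
      codes-nonempty = suc-pred (suc b ^ suc a) {{m^n≢0 (suc b) (suc a)}}

    encodeFun : (Fin (suc a) → Fin (suc b)) → Fin (suc (pred (suc b ^ suc a)))
    encodeFun f = cast (sym codes-nonempty) (funToFin f)

    decodeFun : Fin (suc (pred (suc b ^ suc a))) → Fin (suc a) → Fin (suc b)
    decodeFun c = finToFun (cast codes-nonempty c)

    decodeFun-encodeFun : ∀ f x → decodeFun (encodeFun f) x ≡ f x
    decodeFun-encodeFun f x =
      trans (cong (λ c → finToFun c x) (cast-involutive codes-nonempty (sym codes-nonempty) (funToFin f)))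
            (finToFun-funToFin f x)

  module _ (A F : Struct τ) where

    apply : Fin (suc (pred (suc (n F) ^ suc (n A)))) → Dom A → Dom F
    apply = decodeFun (n A) (n F)

    ⊸-rel? : ∀ R u → Dec (∀ s → Holds A R s → Holds F R (zipWith apply u s))
    ⊸-rel? R u = allVec? λ s → (rel A R s ≟ true) →-dec (rel F R (zipWith apply u s) ≟ true)

  _⊸_ : Struct τ → Struct τ → Struct τ
  A ⊸ F = record { n = pred (suc (n F) ^ suc (n A)) ; rel = λ R u → does (⊸-rel? A F R u) }

  rel-⊸ : ∀ (A F : Struct τ) R u →
          Holds (A ⊸ F) R u ⇔ (∀ s → Holds A R s → Holds F R (zipWith (apply A F) u s))
  rel-⊸ A F R u = does⇔ (⊸-rel? A F R u)

  curry : ∀ {D A F : Struct τ} → D ⊗ A ⟶ F → D ⟶ A ⊸ F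
  curry {D} {A} {F} (h , h-hom) = c , c-hom
    where
    c : Dom D → Dom (A ⊸ F)
    c d = encodeFun (n A) (n F) (λ x → h (combine d x))

    apply-c : ∀ {r} (t : Vec (Dom D) r) s →
              zipWith (apply A F) (map c t) s ≡ map h (zipWith combine t s)
    apply-c t s = trans (zipWith-map₁ (apply A F) c t s)
                        (zipWith-factor (λ d → decodeFun-encodeFun (n A) (n F) (h ∘ combine d)) t s)

    c-hom : IsHom D (A ⊸ F) c
    c-hom R t Rt = from (rel-⊸ A F R (map c t)) λ s Rs →
      subst (Holds F R) (sym (apply-c t s)) (h-hom R (zipWith combine t s) (from (rel-⊗ D A R _)
        ( subst (Holds D R) (sym (map-zipWith-fst (λ x y → cong proj₁ (remQuot-combine x y)) t s)) Rt
        , subst (Holds A R) (sym (map-zipWith-snd (λ x y → cong proj₂ (remQuot-combine x y)) t s)) Rs)))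

  uncurry-diagonal : ∀ {A F : Struct τ} → A ⟶ A ⊸ F → A ⟶ F
  uncurry-diagonal {A} {F} (g , g-hom) = (λ x → apply A F (g x) x) , λ R t Rt →
    subst (Holds F R)
          (trans (zipWith-map₁ (apply A F) g t t) (zipWith-diagonal (λ x → apply A F (g x)) t))
          (to (rel-⊸ A F R (map g t)) (g-hom R t Rt) t Rt)

  module _ (alg : Adaptive τ) where

    Run-functional : ∀ {D σ a a′} → Run alg D σ a → Run alg D σ a′ → a ≡ a′
    Run-functional (stop-yes _ _)  (stop-yes _ _)    = refl
    Run-functional (stop-no _ _)   (stop-no _ _)     = refl
    Run-functional (step _ l h r)  (step _ l′ h′ r′)
      with refl ← trans (sym l) l′ with refl ← ≡-by-truth h h′ id id = Run-functional r r′
    Run-functional (stop-yes _ l)  (stop-no _ l′)    with () ← trans (sym l) l′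
    Run-functional (stop-yes _ l)  (step _ l′ _ _)   with () ← trans (sym l) l′
    Run-functional (stop-no _ l)   (stop-yes _ l′)   with () ← trans (sym l) l′
    Run-functional (stop-no _ l)   (step _ l′ _ _)   with () ← trans (sym l) l′
    Run-functional (step _ l _ _)  (stop-yes _ l′)   with () ← trans (sym l) l′
    Run-functional (step _ l _ _)  (stop-no _ l′)    with () ← trans (sym l) l′

    depth : ∀ {D σ a} → Run alg D σ a → ℕ
    depth (stop-yes _ _)  = zero
    depth (stop-no _ _)   = zero
    depth (step _ _ _ r)  = suc (depth r)

    queriesOf : ∀ {D σ a} (r : Run alg D σ a) → Vec (Struct τ) (depth r)
    queriesOf (stop-yes _ _)          = []
    queriesOf (stop-no _ _)           = []
    queriesOf (step {F = F} _ _ _ r)  = F ∷ queriesOf r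

    answersOf : ∀ {D σ a} (r : Run alg D σ a) → Vec Bool (depth r)
    answersOf (stop-yes _ _)          = []
    answersOf (stop-no _ _)           = []
    answersOf (step {b = b} _ _ _ r)  = b ∷ answersOf r

    SameAnswers : ∀ {D σ a} → Run alg D σ a → Struct τ → Set
    SameAnswers r E = ∀ i → HomBit E (lookup (queriesOf r) i) (lookup (answersOf r) i)

    answersOf-spec : ∀ {D σ a} (r : Run alg D σ a) → SameAnswers r D
    answersOf-spec (step _ _ h r) zero     = h
    answersOf-spec (step _ _ h r) (suc i)  = answersOf-spec r i

    Run-replay : ∀ {D σ a} (r : Run alg D σ a) {E} → SameAnswers r E → Run alg E σ a
    Run-replay (stop-yes t l)  same = stop-yes t l
    Run-replay (stop-no t l)   same = stop-no t l
    Run-replay (step t l _ r)  same = step t l (same zero) (Run-replay r (same ∘ suc))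

  LengthAtMost : ℕ → List Bool → Set
  LengthAtMost k       []      = ⊤
  LengthAtMost zero    (_ ∷ _) = ⊥
  LengthAtMost (suc k) (_ ∷ σ) = LengthAtMost k σ

  LengthAtMost-++⁻ : ∀ k σ ρ → LengthAtMost k (σ ++ ρ) → LengthAtMost k σ
  LengthAtMost-++⁻ k       []      ρ _  = tt
  LengthAtMost-++⁻ (suc k) (_ ∷ σ) ρ ≤k = LengthAtMost-++⁻ k σ ρ ≤k

  verdict : Bool → Label τ
  verdict true  = YES
  verdict false = NO

  answer : Bool → Answer
  answer true  = yes
  answer false = no

  answer-yes⁻ : ∀ {b} → answer b ≡ yes → b ≡ true
  answer-yes⁻ {true} _ = refl

  stop : ∀ {alg : Adaptive τ} {D σ} b →
         tree alg σ → label alg σ ≡ verdict b → Run alg D σ (answer b)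
  stop true  = stop-yes
  stop false = stop-no

  queryAllLabel : ∀ {k} → Vec (Struct τ) k → (Vec Bool k → Bool) → List Bool → Label τ
  queryAllLabel []       X []      = verdict (X [])
  queryAllLabel []       X (_ ∷ _) = NO    -- not a node of the tree
  queryAllLabel (F ∷ Fs) X []      = query F
  queryAllLabel (F ∷ Fs) X (b ∷ σ) = queryAllLabel Fs (X ∘ (b ∷_)) σ

  queryAllLabel-leaf : ∀ {k} (Fs : Vec (Struct τ) k) X σ → LengthAtMost k σ →
    (queryAllLabel Fs X σ ≡ YES ⊎ queryAllLabel Fs X σ ≡ NO) ⇔
    (¬ Σ Bool λ b → Σ (List Bool) λ ρ → LengthAtMost k (σ ++ (b ∷ ρ)))
  queryAllLabel-leaf []       X []      _  = mk⇔ (λ _ → λ ()) (λ _ → verdict-final (X []))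
    where
    verdict-final : ∀ b → verdict b ≡ YES ⊎ verdict b ≡ NO
    verdict-final true  = inj₁ refl
    verdict-final false = inj₂ refl
  queryAllLabel-leaf (F ∷ Fs) X []      _  =
    mk⇔ (λ { (inj₁ ()) ; (inj₂ ()) }) (λ final → ⊥-elim (final (true , [] , tt)))
  queryAllLabel-leaf (F ∷ Fs) X (b ∷ σ) ≤k = queryAllLabel-leaf Fs (X ∘ (b ∷_)) σ ≤k

  queryAll : ∀ {k} → Vec (Struct τ) k → (Vec Bool k → Bool) → Adaptive τ
  queryAll {k} Fs X = record
    { tree          = LengthAtMost k
    ; label         = queryAllLabel Fs X
    ; prefix-closed = LengthAtMost-++⁻ k
    ; leaf-answer   = queryAllLabel-leaf Fs X
    }

  queryAll-run-∷ : ∀ {k F} {Fs : Vec (Struct τ) k} {X b D σ a} →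
    Run (queryAll Fs (X ∘ (b ∷_))) D σ a → Run (queryAll (F ∷ Fs) X) D (b ∷ σ) a
  queryAll-run-∷ (stop-yes t l)  = stop-yes t l
  queryAll-run-∷ (stop-no t l)   = stop-no t l
  queryAll-run-∷ (step t l h r)  = step t l h (queryAll-run-∷ r)

  queryAll-run : ∀ {k} (Fs : Vec (Struct τ) k) X {D} bs → (∀ i → HomBit D (lookup Fs i) (lookup bs i)) →
                 Run (queryAll Fs X) D [] (answer (X bs))
  queryAll-run []       X []       _    = stop (X []) tt refl
  queryAll-run (F ∷ Fs) X (b ∷ bs) bits =
    step tt refl (bits zero) (queryAll-run-∷ (queryAll-run Fs (X ∘ (b ∷_)) bs (bits ∘ suc)))

  nonAdaptive⇒adaptive : ∀ {C : Class τ} → NonAdaptivelyDecidable C → AdaptivelyDecidable C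
  nonAdaptive⇒adaptive {C} (k , alg , decides) =
    queryAll Fs X , (λ D → _ , run D) , λ D → mk⇔ (accepted D) (member D)
    where
    Fs : Vec (Struct τ) k
    Fs = queries alg

    X : Vec Bool k → Bool
    X = accept alg

    bits : Struct τ → Vec Bool k
    bits D = tabulate (homBit D ∘ lookup Fs)

    bits-spec : ∀ D i → HomBit D (lookup Fs i) (lookup (bits D) i)
    bits-spec D i = subst (HomBit D (lookup Fs i)) (sym (lookup∘tabulate _ i)) (homBit-spec D (lookup Fs i))

    run : ∀ D → Run (queryAll Fs X) D [] (answer (X (bits D)))
    run D = queryAll-run Fs X (bits D) (bits-spec D)

    accepted : ∀ D → C D → Run (queryAll Fs X) D [] yes
    accepted D D∈C = subst (Run _ D []) (cong answer (to (decides D (bits D) (bits-spec D)) D∈C)) (run D)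

    member : ∀ D → Run (queryAll Fs X) D [] yes → C D
    member D acc = from (decides D (bits D) (bits-spec D)) (answer-yes⁻ (Run-functional _ (run D) acc))

  adaptive⇒nonAdaptive-[]↔ : ∀ {A : Struct τ} →
    AdaptivelyDecidable (HomEquivClass A) → NonAdaptivelyDecidable (HomEquivClass A)
  adaptive⇒nonAdaptive-[]↔ {A} (alg , _ , decides) = depth alg r , algorithm , correct
    where
    r : Run alg A [] yes
    r = to (decides A) (⟶-refl , ⟶-refl)

    F : Fin (depth alg r) → Struct τ
    F = lookup (queriesOf alg r)

    b : Fin (depth alg r) → Bool
    b = lookup (answersOf alg r)

    algorithm : NonAdaptive τ (depth alg r)
    algorithm = record
      { queries = queriesOf alg r
      ; accept  = λ bs → does (all? λ i → lookup bs i ≟ b i)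
      }

    correct : NADecides algorithm (HomEquivClass A)
    correct D bs bits = mk⇔
      (λ (A⟶D , D⟶A) → from (does⇔ (all? _)) λ i →
         ≡-by-truth (bits i) (answersOf-spec alg r i)
           (⟶-trans {B = D} {C = F i} A⟶D) (⟶-trans {B = A} {C = F i} D⟶A))
      (λ accepted → from (decides D) (Run-replay alg r λ i →
         subst (HomBit D (F i)) (to (does⇔ (all? _)) accepted i) (bits i)))

  adaptive⇒nonAdaptive-↑ : ∀ {A : Struct τ} →
    AdaptivelyDecidable (UpClass A) → NonAdaptivelyDecidable (UpClass A)
  adaptive⇒nonAdaptive-↑ {A} (alg , _ , decides) = depth alg r , algorithm , correct
    where
    r : Run alg A [] yes
    r = to (decides A) ⟶-refl

    F : Fin (depth alg r) → Struct τ
    F = lookup (queriesOf alg r)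

    b : Fin (depth alg r) → Bool
    b = lookup (answersOf alg r)

    algorithm : NonAdaptive τ (depth alg r)
    algorithm = record
      { queries = map (A ⊸_) (queriesOf alg r)
      ; accept  = λ bs → does (all? λ i → (lookup bs i ≟ true) →-dec (b i ≟ true))
      }

    correct : NADecides algorithm (UpClass A)
    correct D bs bits = mk⇔ complete sound
      where
      bits⊸ : ∀ i → HomBit D (A ⊸ F i) (lookup bs i)
      bits⊸ i = subst (λ G → HomBit D G (lookup bs i)) (lookup-map i (A ⊸_) (queriesOf alg r)) (bits i)

      complete : A ⟶ D → accept algorithm bs ≡ true
      complete A⟶D = from (does⇔ (all? _)) λ i D⟶A⊸F →
        from (answersOf-spec alg r i)
          (uncurry-diagonal {F = F i} (⟶-trans {B = D} {C = A ⊸ F i} A⟶D (to (bits⊸ i) D⟶A⊸F)))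

      product-answers : accept algorithm bs ≡ true → SameAnswers alg r (D ⊗ A)
      product-answers accepted i = mk⇔
        (λ bᵢ → ⟶-trans {B = A} {C = F i} (π₂ D A) (to (answersOf-spec alg r i) bᵢ))
        (λ D⊗A⟶F → to (does⇔ (all? _)) accepted i (from (bits⊸ i) (curry {F = F i} D⊗A⟶F)))

      sound : accept algorithm bs ≡ true → A ⟶ D
      sound accepted =
        ⟶-trans {B = D ⊗ A} {C = D}
          (from (decides (D ⊗ A)) (Run-replay alg r (product-answers accepted))) (π₁ D A)

theorem31 : (τ : Signature) (A : Struct τ) (κ : Kind) →
    AdaptivelyDecidable (classOf κ A) ⇔ NonAdaptivelyDecidable (classOf κ A)
theorem31 τ A equivClass = mk⇔ adaptive⇒nonAdaptive-[]↔ nonAdaptive⇒adaptive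
theorem31 τ A upClass    = mk⇔ adaptive⇒nonAdaptive-↑ nonAdaptive⇒adaptive
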